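{- Let $b$ be a positive integer. Consider $b$-colored partitions of $n$ into odd parts: finite multisets of colored parts $r_c$ with $r$ a positive odd integer and $c\in\{1,\dots,b\}$, whose sizes $r$ (counted with multiplicity) sum to $n$. Let $F^o_k(n)$ be the total number of parts of size $k$ (of any color, with multiplicity) in all such partitions of $n$. For such a partition $\pi$, let $g^o_k(\pi)$ be the number of distinct colored parts $r_c$ that occur at least $k$ times in $\pi$, and let $G^o_k(n)=\sum_\pi g^o_k(\pi)$ over all $b$-colored partitions $\pi$ of $n$ into odd parts, with $G^o_k(m)=0$ for $m\le 0$. Then for all $n=1,2,\dots$ and all odd $k=1,3,5,\dots$, $$F^o_k(n)=G^o_k(n)+G^o_k(n-k).$$ -}

module Defs where

open import Data.Nat using (ℕ; zero; suc; _+_; _*_; _≡ᵇ_; _≤ᵇ_)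
open import Data.Nat.Properties using ()
open import Data.Bool using (Bool; true; false; if_then_else_; _∧_)
open import Data.Fin using (Fin; toℕ)
open import Data.List using (List; []; _∷_; [_]; map; concatMap; upTo; filterᵇ)
open import Data.Nat.ListAction using (sum)
open import Data.Vec as V using (Vec; tabulate; zipWith)
open import Data.Product using (∃; _×_)
open import Relation.Binary.PropositionalEquality using (_≡_)

Odd : ℕ → Set
Odd k = ∃ λ j → k ≡ suc (2 * j)

isEvenᵇ : ℕ → Bool
isEvenᵇ zero = true
isEvenᵇ (suc zero) = false
isEvenᵇ (suc (suc n)) = isEvenᵇ n

vecsOf : {A : Set} → List A → (len : ℕ) → List (Vec A len)
vecsOf xs zero = [ V.[] ]
vecsOf xs (suc len) = concatMap (λ x → map (x V.∷_) (vecsOf xs len)) xs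

-- A b-colored "multiplicity table" for parts of size 1..n:
-- π c i = multiplicity of the colored part (toℕ i + 1)_c  (colors c : Fin b).
-- A partition of n never contains a part larger than n, nor a multiplicity > n,
-- so such tables (with entries ≤ n) represent all candidate partitions of n.
Mult : ℕ → ℕ → Set
Mult b n = Vec (Vec ℕ n) b

sizes : (n : ℕ) → Vec ℕ n
sizes n = tabulate (λ (i : Fin n) → suc (toℕ i))

rowWeight : {n : ℕ} → Vec ℕ n → ℕ
rowWeight {n} row = V.sum (zipWith _*_ (sizes n) row)

rowOddOnly : {n : ℕ} → Vec ℕ n → Bool
rowOddOnly {n} row =
  V.foldr _ _∧_ true (zipWith (λ s m → if isEvenᵇ s then m ≡ᵇ 0 else true) (sizes n) row)

weight : {b n : ℕ} → Mult b n → ℕ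
weight π = V.sum (V.map rowWeight π)

oddOnly : {b n : ℕ} → Mult b n → Bool
oddOnly π = V.foldr _ _∧_ true (V.map rowOddOnly π)

isOddPartitionᵇ : {b n : ℕ} → Mult b n → Bool
isOddPartitionᵇ {b} {n} π = (weight π ≡ᵇ n) ∧ oddOnly π

allMult : (b n : ℕ) → List (Mult b n)
allMult b n = vecsOf (vecsOf (upTo (suc n)) n) b

oddPartitions : (b n : ℕ) → List (Mult b n)
oddPartitions b n = filterᵇ isOddPartitionᵇ (allMult b n)

partsOfSize : {b n : ℕ} → ℕ → Mult b n → ℕ
partsOfSize {n = n} k π =
  V.sum (V.map (λ row → V.sum (zipWith (λ s m → if s ≡ᵇ k then m else 0) (sizes n) row)) π)

g : {b n : ℕ} → ℕ → Mult b n → ℕ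
g k π = V.sum (V.map (λ row → V.sum (V.map (λ m → if k ≤ᵇ m then 1 else 0) row)) π)

F : (b k n : ℕ) → ℕ
F b k n = sum (map (partsOfSize k) (oddPartitions b n))

G : (b k n : ℕ) → ℕ
G b k n = sum (map (g k) (oddPartitions b n))

-- The sums are computed with generating functions truncated at degree N.  A
-- b-coloured odd partition is a tuple of multiplicities, one per coloured part
-- size, so summing a sum of per-part marks over the partitions of N reads off
-- the coefficient of X^N in a product-rule expansion of
-- P = (∏ₛ ∑ₘ X^(s·m))^b.  For an odd part size s, the partitions with at least
-- j copies of s are, after removing j copies, all partitions of a number
-- smaller by s·j.  Writing a multiplicity m as ∑_{j ≥ 1} [j ≤ m] this gives
-- F(n) = b ∑_{j ≥ 1} p(n − jk) and G(n) = b ∑_{s odd} p(n − sk), where p(m)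
-- counts the b-coloured odd partitions of m.  Every j ≥ 1 is either an odd s
-- or s + 1 with s odd, and p(n − (s + 1)k) = p((n − k) − sk), which is the
-- identity F(n) = G(n) + G(n − k); the truncations at n and at n − k agree in
-- the degrees that matter.

module Submission where

open import Data.Bool using (Bool; true; false; _∧_; not; if_then_else_; T)
import Data.Fin as Fin
open import Data.List using (List; []; _∷_; [_]; _++_; map; concatMap; filterᵇ; upTo; applyUpTo; replicate)
open import Data.List.Membership.Propositional using (_∈_)
open import Data.List.Membership.Propositional.Properties using (∈-upTo⁻)
open import Data.List.Properties using (map-++; map-applyUpTo; map-upTo; upTo-∷ʳ)
open import Data.List.Relation.Unary.All using (All; []; _∷_)
open import Data.List.Relation.Unary.All.Properties using (applyUpTo⁺₂; replicate⁺)
open import Data.List.Relation.Unary.Any using (here; there)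
open import Data.Nat
open import Data.Nat.ListAction using (sum)
open import Data.Nat.ListAction.Properties using (sum-++)
open import Data.Nat.Properties
open import Algebra.Properties.CommutativeSemigroup +-commutativeSemigroup
  using () renaming (interchange to +-interchange)
open import Algebra.Properties.CommutativeSemigroup *-commutativeSemigroup
  using () renaming (xy∙z≈y∙xz to *-xy∙z≈y∙xz; x∙yz≈y∙xz to *-x∙yz≈y∙xz)
open import Data.Nat.Tactic.RingSolver using (solve-∀)
open import Data.Product using (_,_)
open import Data.Unit using (⊤; tt)
open import Data.Vec as V using (Vec; []; _∷_; zipWith; toList)
open import Data.Vec.Properties using (toList-replicate; map-cong)
open import Function using (_∘_; id)
open import Relation.Binary.PropositionalEquality hiding ([_])
open import Relation.Nullary using (¬_; contradiction)

open import Defs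

open ≡-Reasoning

private
  variable
    A B I : Set
    L : ℕ

-- Iverson brackets and finite sums

⟦_⟧ : Bool → ℕ
⟦ b ⟧ = if b then 1 else 0

⟦∧⟧ : ∀ a b → ⟦ a ∧ b ⟧ ≡ ⟦ a ⟧ * ⟦ b ⟧
⟦∧⟧ true b = sym (+-identityʳ ⟦ b ⟧)
⟦∧⟧ false b = refl

⟦⟧-T : ∀ {b} → T b → ⟦ b ⟧ ≡ 1
⟦⟧-T {true} _ = refl

⟦⟧-¬T : ∀ {b} → ¬ T b → ⟦ b ⟧ ≡ 0
⟦⟧-¬T {true} ¬t = contradiction _ ¬t
⟦⟧-¬T {false} _ = refl

⟦≡ᵇ⟧-> : ∀ {m n} → n < m → ⟦ m ≡ᵇ n ⟧ ≡ 0
⟦≡ᵇ⟧-> {m} {n} n<m = ⟦⟧-¬T λ t → <-irrefl (sym (≡ᵇ⇒≡ m n t)) n<m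

∑ : List A → (A → ℕ) → ℕ
∑ xs f = sum (map f xs)

syntax ∑ xs (λ x → e) = ∑[ x ∈ xs ] e

∑-cong : (xs : List A) {f g : A → ℕ} → (∀ {x} → x ∈ xs → f x ≡ g x) → ∑ xs f ≡ ∑ xs g
∑-cong [] f≗g = refl
∑-cong (x ∷ xs) f≗g = cong₂ _+_ (f≗g (here refl)) (∑-cong xs (f≗g ∘ there))

∑-zero : (xs : List A) {f : A → ℕ} → (∀ {x} → x ∈ xs → f x ≡ 0) → ∑ xs f ≡ 0
∑-zero [] f≡0 = refl
∑-zero (x ∷ xs) f≡0 = cong₂ _+_ (f≡0 (here refl)) (∑-zero xs (f≡0 ∘ there))

∑-distrib-+ : (xs : List A) (f g : A → ℕ) → ∑[ x ∈ xs ] (f x + g x) ≡ ∑ xs f + ∑ xs g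
∑-distrib-+ [] f g = refl
∑-distrib-+ (x ∷ xs) f g =
  trans (cong (f x + g x +_) (∑-distrib-+ xs f g)) (+-interchange (f x) (g x) _ _)

∑-*ˡ : (xs : List A) (c : ℕ) (f : A → ℕ) → ∑[ x ∈ xs ] (c * f x) ≡ c * ∑ xs f
∑-*ˡ [] c f = sym (*-zeroʳ c)
∑-*ˡ (x ∷ xs) c f = trans (cong (c * f x +_) (∑-*ˡ xs c f)) (sym (*-distribˡ-+ c (f x) _))

∑-*ʳ : (xs : List A) (c : ℕ) (f : A → ℕ) → ∑[ x ∈ xs ] (f x * c) ≡ ∑ xs f * c
∑-*ʳ xs c f = begin
  ∑[ x ∈ xs ] (f x * c) ≡⟨ ∑-cong xs (λ {x} _ → *-comm (f x) c) ⟩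
  ∑[ x ∈ xs ] (c * f x) ≡⟨ ∑-*ˡ xs c f ⟩
  c * ∑ xs f
    ≡⟨ *-comm c _ ⟩
  ∑ xs f * c ∎

∑-++ : (xs ys : List A) (f : A → ℕ) → ∑ (xs ++ ys) f ≡ ∑ xs f + ∑ ys f
∑-++ xs ys f = trans (cong sum (map-++ f xs ys)) (sum-++ (map f xs) (map f ys))

∑-map : (g : B → A) (xs : List B) (f : A → ℕ) → ∑ (map g xs) f ≡ ∑ xs (f ∘ g)
∑-map g [] f = refl
∑-map g (x ∷ xs) f = cong (f (g x) +_) (∑-map g xs f)

∑-concatMap : (g : B → List A) (xs : List B) (f : A → ℕ) → ∑ (concatMap g xs) f ≡ ∑[ x ∈ xs ] ∑ (g x) f
∑-concatMap g [] f = refl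
∑-concatMap g (x ∷ xs) f = trans (∑-++ (g x) _ f) (cong (∑ (g x) f +_) (∑-concatMap g xs f))

∑-filterᵇ : (p : A → Bool) (xs : List A) (f : A → ℕ) → ∑ (filterᵇ p xs) f ≡ ∑[ x ∈ xs ] (⟦ p x ⟧ * f x)
∑-filterᵇ p [] f = refl
∑-filterᵇ p (x ∷ xs) f with p x
... | true = cong₂ _+_ (sym (+-identityʳ (f x))) (∑-filterᵇ p xs f)
... | false = ∑-filterᵇ p xs f

∑-comm : (xs : List A) (ys : List B) (f : A → B → ℕ) → ∑[ x ∈ xs ] ∑ ys (f x) ≡ ∑[ y ∈ ys ] ∑[ x ∈ xs ] f x y
∑-comm [] ys f = sym (∑-zero ys (λ _ → refl))
∑-comm (x ∷ xs) ys f = trans (cong (∑ ys (f x) +_) (∑-comm xs ys f)) (sym (∑-distrib-+ ys (f x) _))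

∑-replicate : ∀ n (x : A) (f : A → ℕ) → ∑ (replicate n x) f ≡ n * f x
∑-replicate zero x f = refl
∑-replicate (suc n) x f = cong (f x +_) (∑-replicate n x f)

applyUpTo-++ : (f : ℕ → A) (m n : ℕ) → applyUpTo f (m + n) ≡ applyUpTo f m ++ applyUpTo (f ∘ (m +_)) n
applyUpTo-++ f zero n = refl
applyUpTo-++ f (suc m) n = cong (f 0 ∷_) (applyUpTo-++ (f ∘ suc) m n)

∑-applyUpTo : (g : ℕ → A) (n : ℕ) (f : A → ℕ) → ∑ (applyUpTo g n) f ≡ ∑ (upTo n) (f ∘ g)
∑-applyUpTo g n f = trans (cong sum (map-applyUpTo g f n)) (cong sum (sym (map-upTo (f ∘ g) n)))

∑-upTo-∷ʳ : ∀ n (f : ℕ → ℕ) → ∑ (upTo (suc n)) f ≡ ∑ (upTo n) f + f n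
∑-upTo-∷ʳ n f = begin
  ∑ (upTo (suc n)) f
    ≡⟨ cong (λ is → ∑ is f) (upTo-∷ʳ n) ⟨
  ∑ (upTo n ++ [ n ]) f
    ≡⟨ ∑-++ (upTo n) [ n ] f ⟩
  ∑ (upTo n) f + (f n + 0)
    ≡⟨ cong (∑ (upTo n) f +_) (+-identityʳ (f n)) ⟩
  ∑ (upTo n) f + f n ∎

∑-upTo-++ : ∀ m n (f : ℕ → ℕ) → ∑ (upTo (m + n)) f ≡ ∑ (upTo m) f + ∑[ i ∈ upTo n ] f (m + i)
∑-upTo-++ m n f = begin
  ∑ (upTo (m + n)) f
    ≡⟨ cong (λ is → ∑ is f) (applyUpTo-++ id m n) ⟩
  ∑ (upTo m ++ applyUpTo (m +_) n) f
    ≡⟨ ∑-++ (upTo m) _ f ⟩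
  ∑ (upTo m) f + ∑ (applyUpTo (m +_) n) f
    ≡⟨ cong (∑ (upTo m) f +_) (∑-applyUpTo (m +_) n f) ⟩
  ∑ (upTo m) f + ∑[ i ∈ upTo n ] f (m + i) ∎

∑-upTo-extend : ∀ {m n} (f g : ℕ → ℕ) → m ≤ n → (∀ i → i < m → f i ≡ g i) → (∀ i → m ≤ i → i < n → g i ≡ 0) →
  ∑ (upTo m) f ≡ ∑ (upTo n) g
∑-upTo-extend {m} {n} f g m≤n f≡g g≡0 = begin
  ∑ (upTo m) f
    ≡⟨ ∑-cong (upTo m) (λ {i} i∈ → f≡g i (∈-upTo⁻ i∈)) ⟩
  ∑ (upTo m) g
    ≡⟨ +-identityʳ _ ⟨
  ∑ (upTo m) g + 0
    ≡⟨ cong (∑ (upTo m) g +_) (∑-zero (upTo (n ∸ m)) λ {i} i∈ → g≡0 (m + i) (m≤m+n m i) (beyond i∈)) ⟨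
  ∑ (upTo m) g + ∑[ i ∈ upTo (n ∸ m) ] g (m + i)
    ≡⟨ ∑-upTo-++ m (n ∸ m) g ⟨
  ∑ (upTo (m + (n ∸ m))) g
    ≡⟨ cong (λ k → ∑ (upTo k) g) (m+[n∸m]≡n m≤n) ⟩
  ∑ (upTo n) g ∎
  where
  beyond : ∀ {i} → i ∈ upTo (n ∸ m) → m + i < n
  beyond i∈ = subst (_ <_) (m+[n∸m]≡n m≤n) (+-monoʳ-< m (∈-upTo⁻ i∈))

∑-upTo-⟦<ᵇ⟧ : ∀ {m n} → m ≤ n → ∑[ j ∈ upTo n ] ⟦ j <ᵇ m ⟧ ≡ m
∑-upTo-⟦<ᵇ⟧ {n = n} z≤n = ∑-zero (upTo n) λ _ → refl
∑-upTo-⟦<ᵇ⟧ {suc m} {suc n} (s≤s m≤n) = cong suc (trans (∑-applyUpTo suc n _) (∑-upTo-⟦<ᵇ⟧ m≤n))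

∑-upTo-⟦≡ᵇ⟧ : ∀ n c X → ∑[ i ∈ upTo n ] (⟦ i ≡ᵇ c ⟧ * X) ≡ ⟦ c <ᵇ n ⟧ * X
∑-upTo-⟦≡ᵇ⟧ zero c X = refl
∑-upTo-⟦≡ᵇ⟧ (suc n) zero X = trans (cong (X + 0 +_) (trans (∑-applyUpTo suc n _) (∑-zero (upTo n) λ _ → refl))) (+-identityʳ (X + 0))
∑-upTo-⟦≡ᵇ⟧ (suc n) (suc c) X = trans (∑-applyUpTo suc n _) (∑-upTo-⟦≡ᵇ⟧ n c X)

isOddᵇ : ℕ → Bool
isOddᵇ n = not (isEvenᵇ n)

⟦isOddᵇ⟧-+-suc : ∀ n → ⟦ isOddᵇ n ⟧ + ⟦ isOddᵇ (suc n) ⟧ ≡ 1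
⟦isOddᵇ⟧-+-suc zero = refl
⟦isOddᵇ⟧-+-suc (suc zero) = refl
⟦isOddᵇ⟧-+-suc (suc (suc n)) = ⟦isOddᵇ⟧-+-suc n

isEvenᵇ-2*+1 : ∀ c → isEvenᵇ (suc (2 * c)) ≡ false
isEvenᵇ-2*+1 zero = refl
isEvenᵇ-2*+1 (suc c) = trans (cong (isEvenᵇ ∘ suc) (*-suc 2 c)) (isEvenᵇ-2*+1 c)

∑-odd-pairs : ∀ (V : ℕ → ℕ) n →
  ∑[ i ∈ upTo n ] (⟦ isOddᵇ (suc i) ⟧ * V (suc i)) + ∑[ i ∈ upTo n ] (⟦ isOddᵇ (suc i) ⟧ * V (suc (suc i)))
    ≡ ∑[ i ∈ upTo n ] V (suc i) + ⟦ isOddᵇ n ⟧ * V (suc n)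
∑-odd-pairs V zero = refl
∑-odd-pairs V (suc n) = begin
  ∑[ i ∈ upTo (suc n) ] (⟦ isOddᵇ (suc i) ⟧ * V (suc i)) + ∑[ i ∈ upTo (suc n) ] (⟦ isOddᵇ (suc i) ⟧ * V (suc (suc i)))
    ≡⟨ cong₂ _+_ (∑-upTo-∷ʳ n (λ i → ⟦ isOddᵇ (suc i) ⟧ * V (suc i))) (∑-upTo-∷ʳ n (λ i → ⟦ isOddᵇ (suc i) ⟧ * V (suc (suc i)))) ⟩
  (O + c * V₁) + (E + c * V₂)           ≡⟨ +-interchange O (c * V₁) E (c * V₂) ⟩
  (O + E) + (c * V₁ + c * V₂)           ≡⟨ cong (_+ (c * V₁ + c * V₂)) (∑-odd-pairs V n) ⟩
  (S + a * V₁) + (c * V₁ + c * V₂)      ≡⟨ regroup S a c V₁ V₂ ⟩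
  S + (a + c) * V₁ + c * V₂             ≡⟨ cong (λ x → S + x * V₁ + c * V₂) (⟦isOddᵇ⟧-+-suc n) ⟩
  S + 1 * V₁ + c * V₂                   ≡⟨ cong (λ x → S + x + c * V₂) (*-identityˡ V₁) ⟩
  S + V₁ + c * V₂                       ≡⟨ cong (_+ c * V₂) (∑-upTo-∷ʳ n (λ i → V (suc i))) ⟨
  ∑[ i ∈ upTo (suc n) ] V (suc i) + c * V₂ ∎
  where
  O E S : ℕ
  O = ∑[ i ∈ upTo n ] (⟦ isOddᵇ (suc i) ⟧ * V (suc i))
  E = ∑[ i ∈ upTo n ] (⟦ isOddᵇ (suc i) ⟧ * V (suc (suc i)))
  S = ∑[ i ∈ upTo n ] V (suc i)
  a c V₁ V₂ : ℕ
  a = ⟦ isOddᵇ n ⟧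
  c = ⟦ isOddᵇ (suc n) ⟧
  V₁ = V (suc n)
  V₂ = V (suc (suc n))
  regroup : ∀ S a c V₁ V₂ → (S + a * V₁) + (c * V₁ + c * V₂) ≡ S + (a + c) * V₁ + c * V₂
  regroup = solve-∀

∑-odd-split : ∀ (V : ℕ → ℕ) n → V (suc n) ≡ 0 →
  ∑[ i ∈ upTo n ] V (suc i) ≡ ∑[ i ∈ upTo n ] (⟦ isOddᵇ (suc i) ⟧ * V (suc i)) + ∑[ i ∈ upTo n ] (⟦ isOddᵇ (suc i) ⟧ * V (suc (suc i)))
∑-odd-split V n V[1+n]≡0 = begin
  S
    ≡⟨ +-identityʳ S ⟨
  S + 0
    ≡⟨ cong (S +_) (*-zeroʳ ⟦ isOddᵇ n ⟧) ⟨
  S + ⟦ isOddᵇ n ⟧ * 0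
    ≡⟨ cong (λ x → S + ⟦ isOddᵇ n ⟧ * x) V[1+n]≡0 ⟨
  S + ⟦ isOddᵇ n ⟧ * V (suc n) ≡⟨ ∑-odd-pairs V n ⟨
  _ ∎
  where
  S : ℕ
  S = ∑[ i ∈ upTo n ] V (suc i)

-- Power series as coefficient sequences

Series : Set
Series = ℕ → ℕ

infix 4 _≈[_]_

_≈[_]_ : Series → ℕ → Series → Set
f ≈[ N ] g = ∀ w → w ≤ N → f w ≡ g w

infixl 7 _⊛_

_⊛_ : Series → Series → Series
(f ⊛ g) w = ∑[ i ∈ upTo (suc w) ] (f i * g (w ∸ i))

𝟙 : Series
𝟙 w = ⟦ 0 ≡ᵇ w ⟧

shift : ℕ → Series → Series
shift zero f w = f w
shift (suc a) f zero = 0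
shift (suc a) f (suc w) = shift a f w

shifts : List ℕ → Series → Series
shifts as f w = ∑[ a ∈ as ] shift a f w

shift-> : ∀ a (f : Series) {w} → w < a → shift a f w ≡ 0
shift-> (suc a) f {zero} w<a = refl
shift-> (suc a) f {suc w} (s≤s w<a) = shift-> a f w<a

shift-+ : ∀ k a (f : Series) w → shift (k + a) f (k + w) ≡ shift a f w
shift-+ zero a f w = refl
shift-+ (suc k) a f w = shift-+ k a f w

shift-cong : ∀ {N f g} a → f ≈[ N ] g → shift a f ≈[ N ] shift a g
shift-cong zero f≈g w w≤N = f≈g w w≤N
shift-cong (suc a) f≈g zero w≤N = refl
shift-cong (suc a) f≈g (suc w) w<N = shift-cong a f≈g w (<⇒≤ w<N)

shifts-cong : ∀ {N f g} as → f ≈[ N ] g → shifts as f ≈[ N ] shifts as g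
shifts-cong as f≈g w w≤N = ∑-cong as λ {a} _ → shift-cong a f≈g w w≤N

∑-⟦≡ᵇ⟧-shift : ∀ c (h : Series) (w : ℕ) → ∑[ i ∈ upTo (suc w) ] (⟦ c ≡ᵇ i ⟧ * h (w ∸ i)) ≡ shift c h w
∑-⟦≡ᵇ⟧-shift zero h w = begin
  h w + 0 + ∑ (applyUpTo suc w) (λ i → ⟦ 0 ≡ᵇ i ⟧ * h (w ∸ i))
    ≡⟨ cong₂ _+_ (+-identityʳ (h w)) (trans (∑-applyUpTo suc w _) (∑-zero (upTo w) λ _ → refl)) ⟩
  h w + 0
    ≡⟨ +-identityʳ (h w) ⟩
  h w ∎
∑-⟦≡ᵇ⟧-shift (suc c) h zero = refl
∑-⟦≡ᵇ⟧-shift (suc c) h (suc w) = trans (∑-applyUpTo suc (suc w) _) (∑-⟦≡ᵇ⟧-shift c h w)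

𝟙-⊛ : ∀ h w → (𝟙 ⊛ h) w ≡ h w
𝟙-⊛ = ∑-⟦≡ᵇ⟧-shift 0

⊛-cong : ∀ {N f f′ g g′} → f ≈[ N ] f′ → g ≈[ N ] g′ → f ⊛ g ≈[ N ] f′ ⊛ g′
⊛-cong {N} f≈f′ g≈g′ w w≤N = ∑-cong (upTo (suc w)) λ {i} i∈ →
  cong₂ _*_ (f≈f′ i (≤-trans (s≤s⁻¹ (∈-upTo⁻ i∈)) w≤N)) (g≈g′ (w ∸ i) (≤-trans (m∸n≤m w i) w≤N))

⊛-congˡ : ∀ {N f f′} g → f ≈[ N ] f′ → f ⊛ g ≈[ N ] f′ ⊛ g
⊛-congˡ g f≈f′ = ⊛-cong {g = g} f≈f′ (λ _ _ → refl)

⊛-congʳ : ∀ {N g g′} f → g ≈[ N ] g′ → f ⊛ g ≈[ N ] f ⊛ g′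
⊛-congʳ f g≈g′ = ⊛-cong {f = f} (λ _ _ → refl) g≈g′

⊛-shiftˡ : ∀ a f g w → (shift a f ⊛ g) w ≡ shift a (f ⊛ g) w
⊛-shiftˡ zero f g w = refl
⊛-shiftˡ (suc a) f g zero = refl
⊛-shiftˡ (suc a) f g (suc w) = trans (∑-applyUpTo suc (suc w) _) (⊛-shiftˡ a f g w)

⊛-shiftʳ : ∀ a f g w → (f ⊛ shift a g) w ≡ shift a (f ⊛ g) w
⊛-shiftʳ zero f g w = refl
⊛-shiftʳ (suc a) f g zero = trans (+-identityʳ _) (*-zeroʳ (f 0))
⊛-shiftʳ (suc a) f g (suc w) = begin
  (f ⊛ shift (suc a) g) (suc w)
    ≡⟨ ∑-upTo-∷ʳ (suc w) (λ i → f i * shift (suc a) g (suc w ∸ i)) ⟩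
  ∑[ i ∈ upTo (suc w) ] (f i * shift (suc a) g (suc w ∸ i)) + f (suc w) * shift (suc a) g (w ∸ w)
    ≡⟨ cong₂ _+_ (∑-cong (upTo (suc w)) λ {i} i∈ → cong (λ v → f i * shift (suc a) g v) (+-∸-assoc 1 (s≤s⁻¹ (∈-upTo⁻ i∈))))
                 (trans (cong (λ v → f (suc w) * shift (suc a) g v) (n∸n≡0 w)) (*-zeroʳ (f (suc w)))) ⟩
  (f ⊛ shift a g) w + 0
    ≡⟨ +-identityʳ _ ⟩
  (f ⊛ shift a g) w
    ≡⟨ ⊛-shiftʳ a f g w ⟩
  shift a (f ⊛ g) w ∎

⊛-∑ˡ : (xs : List A) (f : A → Series) (g : Series) (w : ℕ) → ((λ u → ∑[ x ∈ xs ] f x u) ⊛ g) w ≡ ∑[ x ∈ xs ] (f x ⊛ g) w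
⊛-∑ˡ xs f g w = trans (∑-cong (upTo (suc w)) λ {i} _ → sym (∑-*ʳ xs (g (w ∸ i)) (λ x → f x i))) (∑-comm (upTo (suc w)) xs _)

⊛-∑ʳ : (xs : List A) (f : Series) (g : A → Series) (w : ℕ) → (f ⊛ (λ u → ∑[ x ∈ xs ] g x u)) w ≡ ∑[ x ∈ xs ] (f ⊛ g x) w
⊛-∑ʳ xs f g w = trans (∑-cong (upTo (suc w)) λ {i} _ → sym (∑-*ˡ xs (f i) (λ x → g x (w ∸ i)))) (∑-comm (upTo (suc w)) xs _)

⊛-shiftsˡ : ∀ as f g w → (shifts as f ⊛ g) w ≡ shifts as (f ⊛ g) w
⊛-shiftsˡ as f g w = trans (⊛-∑ˡ as (λ a → shift a f) g w) (∑-cong as λ {a} _ → ⊛-shiftˡ a f g w)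

⊛-shiftsʳ : ∀ as f g w → (f ⊛ shifts as g) w ≡ shifts as (f ⊛ g) w
⊛-shiftsʳ as f g w = trans (⊛-∑ʳ as f (λ a → shift a g) w) (∑-cong as λ {a} _ → ⊛-shiftʳ a f g w)

∏ : (I → Series) → List I → Series
∏ f [] = 𝟙
∏ f (i ∷ is) = f i ⊛ ∏ f is

-- leibniz f g is = ∑ᵢ gᵢ ⊛ ∏_{j ≠ i} fⱼ: the product rule for ∏ f, with gᵢ in the role of fᵢ′.
leibniz : (I → Series) → (I → Series) → List I → Series
leibniz f g [] w = 0
leibniz f g (i ∷ is) w = (g i ⊛ ∏ f is) w + (f i ⊛ leibniz f g is) w

∏-cong : ∀ {N} {f g : I → Series} is → All (λ i → f i ≈[ N ] g i) is → ∏ f is ≈[ N ] ∏ g is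
∏-cong [] [] w w≤N = refl
∏-cong (i ∷ is) (fᵢ≈gᵢ ∷ f≈g) = ⊛-cong fᵢ≈gᵢ (∏-cong is f≈g)

∏-𝟙 : ∀ {N} (f : I → Series) is → All (λ i → f i ≈[ N ] 𝟙) is → ∏ f is ≈[ N ] 𝟙
∏-𝟙 f [] [] w w≤N = refl
∏-𝟙 f (i ∷ is) (fᵢ≈𝟙 ∷ f≈𝟙) w w≤N = trans (⊛-cong fᵢ≈𝟙 (∏-𝟙 f is f≈𝟙) w w≤N) (𝟙-⊛ 𝟙 w)

∏-++-𝟙 : ∀ {N} (f : I → Series) is js → All (λ j → f j ≈[ N ] 𝟙) js → ∏ f (is ++ js) ≈[ N ] ∏ f is
∏-++-𝟙 f [] js f≈𝟙 = ∏-𝟙 f js f≈𝟙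
∏-++-𝟙 f (i ∷ is) js f≈𝟙 = ⊛-congʳ (f i) (∏-++-𝟙 f is js f≈𝟙)

leibniz-shifts : ∀ {N} (f g : I → Series) (A : I → List ℕ) is →
  All (λ i → g i ≈[ N ] shifts (A i) (f i)) is → leibniz f g is ≈[ N ] shifts (concatMap A is) (∏ f is)
leibniz-shifts f g A [] [] w w≤N = refl
leibniz-shifts f g A (i ∷ is) (gᵢ≈ ∷ g≈) w w≤N = begin
  (g i ⊛ ∏ f is) w + (f i ⊛ leibniz f g is) w
    ≡⟨ cong₂ _+_ (⊛-congˡ (∏ f is) gᵢ≈ w w≤N) (⊛-congʳ (f i) (leibniz-shifts f g A is g≈) w w≤N) ⟩
  (shifts (A i) (f i) ⊛ ∏ f is) w + (f i ⊛ shifts (concatMap A is) (∏ f is)) w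
    ≡⟨ cong₂ _+_ (⊛-shiftsˡ (A i) (f i) (∏ f is) w) (⊛-shiftsʳ (concatMap A is) (f i) (∏ f is) w) ⟩
  shifts (A i) (∏ f (i ∷ is)) w + shifts (concatMap A is) (∏ f (i ∷ is)) w
    ≡⟨ ∑-++ (A i) (concatMap A is) _ ⟨
  shifts (concatMap A (i ∷ is)) (∏ f (i ∷ is)) w ∎

-- Generating functions of weighted lists

gf : List A → (A → ℕ) → (A → ℕ) → Series
gf xs s e w = ∑[ x ∈ xs ] (⟦ s x ≡ᵇ w ⟧ * e x)

gf-shift : ∀ a (xs : List A) (s e : A → ℕ) w → gf xs (λ x → a + s x) e w ≡ shift a (gf xs s e) w
gf-shift zero xs s e w = refl
gf-shift (suc a) xs s e zero = ∑-zero xs λ _ → refl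
gf-shift (suc a) xs s e (suc w) = gf-shift a xs s e w

gf-⊛ : (xs : List A) (s e : A → ℕ) (h : Series) (w : ℕ) → (gf xs s e ⊛ h) w ≡ ∑[ x ∈ xs ] (e x * shift (s x) h w)
gf-⊛ xs s e h w = begin
  ∑[ i ∈ upTo (suc w) ] (gf xs s e i * h (w ∸ i))
    ≡⟨ ⊛-∑ˡ xs (λ x i → ⟦ s x ≡ᵇ i ⟧ * e x) h w ⟩
  ∑[ x ∈ xs ] ∑[ i ∈ upTo (suc w) ] (⟦ s x ≡ᵇ i ⟧ * e x * h (w ∸ i))
    ≡⟨ ∑-cong xs (λ {x} _ → begin
      ∑[ i ∈ upTo (suc w) ] (⟦ s x ≡ᵇ i ⟧ * e x * h (w ∸ i))
        ≡⟨ ∑-cong (upTo (suc w)) (λ {i} _ → *-xy∙z≈y∙xz ⟦ s x ≡ᵇ i ⟧ (e x) _) ⟩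
      ∑[ i ∈ upTo (suc w) ] (e x * (⟦ s x ≡ᵇ i ⟧ * h (w ∸ i)))
        ≡⟨ ∑-*ˡ (upTo (suc w)) (e x) _ ⟩
      e x * ∑[ i ∈ upTo (suc w) ] (⟦ s x ≡ᵇ i ⟧ * h (w ∸ i))
        ≡⟨ cong (e x *_) (∑-⟦≡ᵇ⟧-shift (s x) h w) ⟩
      e x * shift (s x) h w ∎) ⟩
  ∑[ x ∈ xs ] (e x * shift (s x) h w) ∎

gf-⊛-gf : (xs : List A) (ys : List B) (s e : A → ℕ) (t f : B → ℕ) (w : ℕ) →
  ∑[ x ∈ xs ] ∑[ y ∈ ys ] (⟦ s x + t y ≡ᵇ w ⟧ * (e x * f y)) ≡ (gf xs s e ⊛ gf ys t f) w
gf-⊛-gf xs ys s e t f w = begin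
  ∑[ x ∈ xs ] ∑[ y ∈ ys ] (⟦ s x + t y ≡ᵇ w ⟧ * (e x * f y))
    ≡⟨ ∑-cong xs (λ {x} _ → ∑-cong ys λ {y} _ → *-x∙yz≈y∙xz ⟦ s x + t y ≡ᵇ w ⟧ (e x) (f y)) ⟩
  ∑[ x ∈ xs ] ∑[ y ∈ ys ] (e x * (⟦ s x + t y ≡ᵇ w ⟧ * f y))
    ≡⟨ ∑-cong xs (λ {x} _ → ∑-*ˡ ys (e x) (λ y → ⟦ s x + t y ≡ᵇ w ⟧ * f y)) ⟩
  ∑[ x ∈ xs ] (e x * gf ys (λ y → s x + t y) f w)
    ≡⟨ ∑-cong xs (λ {x} _ → cong (e x *_) (gf-shift (s x) ys t f w)) ⟩
  ∑[ x ∈ xs ] (e x * shift (s x) (gf ys t f) w)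
    ≡⟨ gf-⊛ xs s e (gf ys t f) w ⟨
  (gf xs s e ⊛ gf ys t f) w ∎

gf-∑ : (xs : List A) (s c : A → ℕ) (js : List B) (E : B → A → ℕ) (w : ℕ) →
  gf xs s (λ x → c x * ∑[ j ∈ js ] E j x) w ≡ ∑[ j ∈ js ] gf xs s (λ x → c x * E j x) w
gf-∑ xs s c js E w = begin
  ∑[ x ∈ xs ] (⟦ s x ≡ᵇ w ⟧ * (c x * ∑[ j ∈ js ] E j x))
    ≡⟨ ∑-cong xs (λ {x} _ → cong (⟦ s x ≡ᵇ w ⟧ *_) (∑-*ˡ js (c x) (λ j → E j x))) ⟨
  ∑[ x ∈ xs ] (⟦ s x ≡ᵇ w ⟧ * ∑[ j ∈ js ] (c x * E j x))
    ≡⟨ ∑-cong xs (λ {x} _ → ∑-*ˡ js ⟦ s x ≡ᵇ w ⟧ (λ j → c x * E j x)) ⟨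
  ∑[ x ∈ xs ] ∑[ j ∈ js ] (⟦ s x ≡ᵇ w ⟧ * (c x * E j x))
    ≡⟨ ∑-comm xs js _ ⟩
  ∑[ j ∈ js ] gf xs s (λ x → c x * E j x) w ∎

gf-multiples-trunc : ∀ {N} s K d (e : ℕ → ℕ) → N < s * K → gf (upTo (K + d)) (s *_) e ≈[ N ] gf (upTo K) (s *_) e
gf-multiples-trunc s K d e N<sK w w≤N = begin
  gf (upTo (K + d)) (s *_) e w                                            ≡⟨ ∑-upTo-++ K d _ ⟩
  gf (upTo K) (s *_) e w + ∑[ i ∈ upTo d ] (⟦ s * (K + i) ≡ᵇ w ⟧ * e (K + i))
    ≡⟨ cong (gf (upTo K) (s *_) e w +_) (∑-zero (upTo d) λ {i} _ → cong (_* e (K + i)) (⟦≡ᵇ⟧-> (beyond i))) ⟩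
  gf (upTo K) (s *_) e w + 0                                              ≡⟨ +-identityʳ _ ⟩
  gf (upTo K) (s *_) e w                                                  ∎
  where
  beyond : ∀ i → w < s * (K + i)
  beyond i = <-≤-trans (≤-<-trans w≤N N<sK) (*-monoʳ-≤ s (m≤m+n K i))

gf-multiples-from : ∀ s j K w → gf (upTo (j + K)) (s *_) (λ m → ⟦ j ≤ᵇ m ⟧) w ≡ shift (s * j) (gf (upTo K) (s *_) (λ _ → 1)) w
gf-multiples-from s j K w = begin
  gf (upTo (j + K)) (s *_) (λ m → ⟦ j ≤ᵇ m ⟧) w                                     ≡⟨ ∑-upTo-++ j K _ ⟩
  ∑[ m ∈ upTo j ] (⟦ s * m ≡ᵇ w ⟧ * ⟦ j ≤ᵇ m ⟧) + ∑[ i ∈ upTo K ] (⟦ s * (j + i) ≡ᵇ w ⟧ * ⟦ j ≤ᵇ j + i ⟧)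
    ≡⟨ cong₂ _+_ (∑-zero (upTo j) λ {m} m∈ → trans (cong (⟦ s * m ≡ᵇ w ⟧ *_) (⟦⟧-¬T λ t → <⇒≱ (∈-upTo⁻ m∈) (≤ᵇ⇒≤ j m t)))
                                                   (*-zeroʳ ⟦ s * m ≡ᵇ w ⟧))
                 (∑-cong (upTo K) λ {i} _ → cong₂ (λ a b → ⟦ a ≡ᵇ w ⟧ * b) (*-distribˡ-+ s j i) (⟦⟧-T (≤⇒≤ᵇ (m≤m+n j i)))) ⟩
  gf (upTo K) (λ i → s * j + s * i) (λ _ → 1) w                                      ≡⟨ gf-shift (s * j) (upTo K) (s *_) (λ _ → 1) w ⟩
  shift (s * j) (gf (upTo K) (s *_) (λ _ → 1)) w                                     ∎

∑-vecsOf : (xs : List A) (L : ℕ) (f : Vec A (suc L) → ℕ) → ∑ (vecsOf xs (suc L)) f ≡ ∑[ x ∈ xs ] ∑[ v ∈ vecsOf xs L ] f (x ∷ v)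
∑-vecsOf xs L f = trans (∑-concatMap _ xs f) (∑-cong xs λ {x} _ → ∑-map (x ∷_) (vecsOf xs L) f)

map-as-zipWith : (is : Vec I L) (f : A → B) (v : Vec A L) → V.map f v ≡ zipWith (λ _ → f) is v
map-as-zipWith [] f [] = refl
map-as-zipWith (i ∷ is) f (x ∷ v) = cong (f x ∷_) (map-as-zipWith is f v)

toList-tabulate-toℕ : ∀ n (f : ℕ → A) → toList (V.tabulate {n = n} (f ∘ Fin.toℕ)) ≡ applyUpTo f n
toList-tabulate-toℕ zero f = refl
toList-tabulate-toℕ (suc n) f = cong (f 0 ∷_) (toList-tabulate-toℕ n (f ∘ suc))

allᵇ : Vec Bool L → Bool
allᵇ = V.foldr (λ _ → Bool) _∧_ true

module ProductFormula (xs : List A) (wt : I → A → ℕ) (adm : I → A → Bool) where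

  counting : I → Series
  counting i = gf xs (wt i) (⟦_⟧ ∘ adm i)

  weightOf : Vec I L → Vec A L → ℕ
  weightOf is v = V.sum (zipWith wt is v)

  admissibleᵇ : Vec I L → Vec A L → Bool
  admissibleᵇ is v = allᵇ (zipWith adm is v)

  product-formula : (is : Vec I L) (w : ℕ) →
    gf (vecsOf xs L) (weightOf is) (⟦_⟧ ∘ admissibleᵇ is) w ≡ ∏ counting (toList is) w
  product-formula [] w = trans (+-identityʳ _) (*-identityʳ _)
  product-formula {suc L} (i ∷ is) w = begin
    gf (vecsOf xs (suc L)) (weightOf (i ∷ is)) (⟦_⟧ ∘ admissibleᵇ (i ∷ is)) w
      ≡⟨ ∑-vecsOf xs L _ ⟩
    ∑[ x ∈ xs ] ∑[ v ∈ vecsOf xs L ] (⟦ wt i x + weightOf is v ≡ᵇ w ⟧ * ⟦ adm i x ∧ admissibleᵇ is v ⟧)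
      ≡⟨ ∑-cong xs (λ {x} _ → ∑-cong (vecsOf xs L) λ {v} _ → cong (⟦ wt i x + weightOf is v ≡ᵇ w ⟧ *_) (⟦∧⟧ (adm i x) _)) ⟩
    ∑[ x ∈ xs ] ∑[ v ∈ vecsOf xs L ] (⟦ wt i x + weightOf is v ≡ᵇ w ⟧ * (⟦ adm i x ⟧ * ⟦ admissibleᵇ is v ⟧))
      ≡⟨ gf-⊛-gf xs (vecsOf xs L) (wt i) (⟦_⟧ ∘ adm i) (weightOf is) (⟦_⟧ ∘ admissibleᵇ is) w ⟩
    (counting i ⊛ gf (vecsOf xs L) (weightOf is) (⟦_⟧ ∘ admissibleᵇ is)) w
      ≡⟨ ⊛-congʳ (counting i) (λ u _ → product-formula is u) w ≤-refl ⟩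
    (counting i ⊛ ∏ counting (toList is)) w ∎

  marking : (I → A → ℕ) → I → Series
  marking mk i = gf xs (wt i) (λ x → ⟦ adm i x ⟧ * mk i x)

  marked-product-formula : (mk : I → A → ℕ) (is : Vec I L) (w : ℕ) →
    gf (vecsOf xs L) (weightOf is) (λ v → ⟦ admissibleᵇ is v ⟧ * V.sum (zipWith mk is v)) w
      ≡ leibniz counting (marking mk) (toList is) w
  marked-product-formula mk [] w = trans (+-identityʳ _) (*-zeroʳ ⟦ 0 ≡ᵇ w ⟧)
  marked-product-formula {suc L} mk (i ∷ is) w = begin
    gf (vecsOf xs (suc L)) (weightOf (i ∷ is)) (λ v → ⟦ admissibleᵇ (i ∷ is) v ⟧ * V.sum (zipWith mk (i ∷ is) v)) w
      ≡⟨ ∑-vecsOf xs L _ ⟩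
    ∑[ x ∈ xs ] ∑[ v ∈ vecsOf xs L ] (⟦ wt i x + weightOf is v ≡ᵇ w ⟧ * (⟦ adm i x ∧ admissibleᵇ is v ⟧ * (mk i x + M v)))
      ≡⟨ ∑-cong xs (λ {x} _ → ∑-cong (vecsOf xs L) λ {v} _ → split (adm i x) (admissibleᵇ is v) ⟦ wt i x + weightOf is v ≡ᵇ w ⟧ (mk i x) (M v)) ⟩
    ∑[ x ∈ xs ] ∑[ v ∈ vecsOf xs L ] (Marked x v + Counted x v)
      ≡⟨ ∑-cong xs (λ {x} _ → ∑-distrib-+ (vecsOf xs L) (Marked x) (Counted x)) ⟩
    ∑[ x ∈ xs ] (∑ (vecsOf xs L) (Marked x) + ∑ (vecsOf xs L) (Counted x))
      ≡⟨ ∑-distrib-+ xs _ _ ⟩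
    ∑[ x ∈ xs ] ∑ (vecsOf xs L) (Marked x) + ∑[ x ∈ xs ] ∑ (vecsOf xs L) (Counted x)
      ≡⟨ cong₂ _+_ (gf-⊛-gf xs (vecsOf xs L) (wt i) _ (weightOf is) _ w) (gf-⊛-gf xs (vecsOf xs L) (wt i) _ (weightOf is) _ w) ⟩
    (marking mk i ⊛ gf (vecsOf xs L) (weightOf is) (⟦_⟧ ∘ admissibleᵇ is)) w
      + (counting i ⊛ gf (vecsOf xs L) (weightOf is) (λ v → ⟦ admissibleᵇ is v ⟧ * M v)) w
      ≡⟨ cong₂ _+_ (⊛-congʳ (marking mk i) (λ u _ → product-formula is u) w ≤-refl)
                   (⊛-congʳ (counting i) (λ u _ → marked-product-formula mk is u) w ≤-refl) ⟩
    (marking mk i ⊛ ∏ counting (toList is)) w + (counting i ⊛ leibniz counting (marking mk) (toList is)) w ∎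
    where
    M : Vec A L → ℕ
    M v = V.sum (zipWith mk is v)
    Marked Counted : A → Vec A L → ℕ
    Marked x v = ⟦ wt i x + weightOf is v ≡ᵇ w ⟧ * ((⟦ adm i x ⟧ * mk i x) * ⟦ admissibleᵇ is v ⟧)
    Counted x v = ⟦ wt i x + weightOf is v ≡ᵇ w ⟧ * (⟦ adm i x ⟧ * (⟦ admissibleᵇ is v ⟧ * M v))
    split : ∀ a b d m q → d * (⟦ a ∧ b ⟧ * (m + q)) ≡ d * (⟦ a ⟧ * m * ⟦ b ⟧) + d * (⟦ a ⟧ * (⟦ b ⟧ * q))
    split a b d m q = trans (cong (λ z → d * (z * (m + q))) (⟦∧⟧ a b)) (distrib ⟦ a ⟧ ⟦ b ⟧ d m q)
      where
      distrib : ∀ x y d m q → d * (x * y * (m + q)) ≡ d * (x * m * y) + d * (x * (y * q))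
      distrib = solve-∀

-- Coloured partitions into odd parts

oddAdmissible : ℕ → ℕ → Bool
oddAdmissible s m = if isEvenᵇ s then m ≡ᵇ 0 else true

oddAdmissible-odd : ∀ s → isEvenᵇ s ≡ false → ∀ m → oddAdmissible s m ≡ true
oddAdmissible-odd s e m rewrite e = refl

oddAdmissible-0 : ∀ s → oddAdmissible s 0 ≡ true
oddAdmissible-0 s with isEvenᵇ s
... | true = refl
... | false = refl

oddAdmissible-even-suc : ∀ s → isEvenᵇ s ≡ true → ∀ m → oddAdmissible s (suc m) ≡ false
oddAdmissible-even-suc s e m rewrite e = refl

-- The generating function of b-coloured odd partitions, one factor per coloured part size, with
-- sizes and multiplicities bounded by N; the bound is invisible in degrees ≤ N (tableGF-trunc).
sizeGF : ℕ → ℕ → Series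
sizeGF N s = gf (upTo (suc N)) (s *_) (⟦_⟧ ∘ oddAdmissible s)

rowGF : ℕ → Series
rowGF N = ∏ (sizeGF N) (applyUpTo suc N)

tableGF : ℕ → ℕ → Series
tableGF b N = ∏ (λ _ → rowGF N) (replicate b tt)

sizeGF-odd : ∀ s → isEvenᵇ s ≡ false → ∀ N w → sizeGF N s w ≡ gf (upTo (suc N)) (s *_) (λ _ → 1) w
sizeGF-odd s e N w = ∑-cong (upTo (suc N)) λ {m} _ → cong (λ a → ⟦ s * m ≡ᵇ w ⟧ * ⟦ a ⟧) (oddAdmissible-odd s e m)

sizeGF-trunc : ∀ M d s .{{_ : NonZero s}} → sizeGF (M + d) s ≈[ M ] sizeGF M s
sizeGF-trunc M d s = gf-multiples-trunc s (suc M) d _ (m≤n*m (suc M) s)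

sizeGF-𝟙 : ∀ M N s → M < s → sizeGF N s ≈[ M ] 𝟙
sizeGF-𝟙 M N s M<s w w≤M = begin
  sizeGF N s w
    ≡⟨ gf-multiples-trunc s 1 N _ (subst (M <_) (sym (*-identityʳ s)) M<s) w w≤M ⟩
  ⟦ s * 0 ≡ᵇ w ⟧ * ⟦ oddAdmissible s 0 ⟧ + 0
    ≡⟨ cong₂ (λ z a → ⟦ z ≡ᵇ w ⟧ * ⟦ a ⟧ + 0) (*-zeroʳ s) (oddAdmissible-0 s) ⟩
  ⟦ 0 ≡ᵇ w ⟧ * 1 + 0
    ≡⟨ trans (+-identityʳ _) (*-identityʳ _) ⟩
  𝟙 w ∎

rowGF-trunc : ∀ M d → rowGF (M + d) ≈[ M ] rowGF M
rowGF-trunc M d w w≤M = begin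
  ∏ (sizeGF (M + d)) (applyUpTo suc (M + d)) w
    ≡⟨ cong (λ ss → ∏ (sizeGF (M + d)) ss w) (applyUpTo-++ suc M d) ⟩
  ∏ (sizeGF (M + d)) (applyUpTo suc M ++ applyUpTo (suc ∘ (M +_)) d) w
    ≡⟨ ∏-++-𝟙 (sizeGF (M + d)) (applyUpTo suc M) _ (applyUpTo⁺₂ _ d λ i → sizeGF-𝟙 M (M + d) (suc (M + i)) (s≤s (m≤m+n M i))) w w≤M ⟩
  ∏ (sizeGF (M + d)) (applyUpTo suc M) w
    ≡⟨ ∏-cong (applyUpTo suc M) (applyUpTo⁺₂ suc M λ i → sizeGF-trunc M d (suc i)) w w≤M ⟩
  ∏ (sizeGF M) (applyUpTo suc M) w ∎

tableGF-trunc : ∀ b M d → tableGF b (M + d) ≈[ M ] tableGF b M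
tableGF-trunc b M d = ∏-cong (replicate b tt) (replicate⁺ b (rowGF-trunc M d))

odd-atLeast-shift : ∀ s .{{_ : NonZero s}} → isEvenᵇ s ≡ false → ∀ N j →
  gf (upTo (suc N)) (s *_) (λ m → ⟦ oddAdmissible s m ⟧ * ⟦ j ≤ᵇ m ⟧) ≈[ N ] shift (s * j) (sizeGF N s)
odd-atLeast-shift s e N j w w≤N = begin
  gf (upTo (suc N)) (s *_) (λ m → ⟦ oddAdmissible s m ⟧ * ⟦ j ≤ᵇ m ⟧) w
    ≡⟨ ∑-cong (upTo (suc N)) (λ {m} _ → cong (⟦ s * m ≡ᵇ w ⟧ *_)
         (trans (cong (λ a → ⟦ a ⟧ * ⟦ j ≤ᵇ m ⟧) (oddAdmissible-odd s e m)) (+-identityʳ _))) ⟩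
  gf (upTo (suc N)) (s *_) (λ m → ⟦ j ≤ᵇ m ⟧) w
    ≡⟨ gf-multiples-trunc s (suc N) j _ (m≤n*m (suc N) s) w w≤N ⟨
  gf (upTo (suc N + j)) (s *_) (λ m → ⟦ j ≤ᵇ m ⟧) w
    ≡⟨ cong (λ K → gf (upTo K) (s *_) (λ m → ⟦ j ≤ᵇ m ⟧) w) (+-comm (suc N) j) ⟩
  gf (upTo (j + suc N)) (s *_) (λ m → ⟦ j ≤ᵇ m ⟧) w
    ≡⟨ gf-multiples-from s j (suc N) w ⟩
  shift (s * j) (gf (upTo (suc N)) (s *_) (λ _ → 1)) w
    ≡⟨ shift-cong (s * j) (λ u _ → sizeGF-odd s e N u) w w≤N ⟨
  shift (s * j) (sizeGF N s) w ∎

odd-multiplicity-shifts : ∀ s .{{_ : NonZero s}} → isEvenᵇ s ≡ false → ∀ N →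
  gf (upTo (suc N)) (s *_) (λ m → ⟦ oddAdmissible s m ⟧ * m) ≈[ N ] shifts (applyUpTo (λ j → s * suc j) N) (sizeGF N s)
odd-multiplicity-shifts s e N w w≤N = begin
  gf (upTo (suc N)) (s *_) (λ m → ⟦ oddAdmissible s m ⟧ * m) w
    ≡⟨ ∑-cong (upTo (suc N)) (λ {m} m∈ → cong (λ x → ⟦ s * m ≡ᵇ w ⟧ * (⟦ oddAdmissible s m ⟧ * x))
         (sym (∑-upTo-⟦<ᵇ⟧ (s≤s⁻¹ (∈-upTo⁻ m∈))))) ⟩
  gf (upTo (suc N)) (s *_) (λ m → ⟦ oddAdmissible s m ⟧ * ∑[ j ∈ upTo N ] ⟦ suc j ≤ᵇ m ⟧) w
    ≡⟨ gf-∑ (upTo (suc N)) (s *_) (⟦_⟧ ∘ oddAdmissible s) (upTo N) (λ j m → ⟦ suc j ≤ᵇ m ⟧) w ⟩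
  ∑[ j ∈ upTo N ] gf (upTo (suc N)) (s *_) (λ m → ⟦ oddAdmissible s m ⟧ * ⟦ suc j ≤ᵇ m ⟧) w
    ≡⟨ ∑-cong (upTo N) (λ {j} _ → odd-atLeast-shift s e N (suc j) w w≤N) ⟩
  ∑[ j ∈ upTo N ] shift (s * suc j) (sizeGF N s) w
    ≡⟨ ∑-applyUpTo (λ j → s * suc j) N (λ a → shift a (sizeGF N s) w) ⟨
  shifts (applyUpTo (λ j → s * suc j) N) (sizeGF N s) w ∎

even-marking-vanishes : ∀ s → isEvenᵇ s ≡ true → (mk : ℕ → ℕ) → mk 0 ≡ 0 →
  ∀ K w → gf (upTo K) (s *_) (λ m → ⟦ oddAdmissible s m ⟧ * mk m) w ≡ 0
even-marking-vanishes s e mk mk0≡0 K w = ∑-zero (upTo K) λ {m} _ → vanishes m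
  where
  vanishes : ∀ m → ⟦ s * m ≡ᵇ w ⟧ * (⟦ oddAdmissible s m ⟧ * mk m) ≡ 0
  vanishes zero = trans (cong (λ x → ⟦ s * 0 ≡ᵇ w ⟧ * (⟦ oddAdmissible s 0 ⟧ * x)) mk0≡0)
                        (trans (cong (⟦ s * 0 ≡ᵇ w ⟧ *_) (*-zeroʳ ⟦ oddAdmissible s 0 ⟧)) (*-zeroʳ ⟦ s * 0 ≡ᵇ w ⟧))
  vanishes (suc m) = trans (cong (λ a → ⟦ s * suc m ≡ᵇ w ⟧ * (⟦ a ⟧ * mk (suc m))) (oddAdmissible-even-suc s e m)) (*-zeroʳ ⟦ s * suc m ≡ᵇ w ⟧)

marksF : ℕ → ℕ → ℕ → List ℕ
marksF N k s = if s ≡ᵇ k then applyUpTo (λ j → s * suc j) N else []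

F-marking-shifts : ∀ k → isEvenᵇ k ≡ false → ∀ N s .{{_ : NonZero s}} →
  gf (upTo (suc N)) (s *_) (λ m → ⟦ oddAdmissible s m ⟧ * (if s ≡ᵇ k then m else 0)) ≈[ N ] shifts (marksF N k s) (sizeGF N s)
F-marking-shifts k k-odd N s with s ≡ᵇ k in e
... | true = odd-multiplicity-shifts s (trans (cong isEvenᵇ (≡ᵇ⇒≡ s k (subst T (sym e) _))) k-odd) N
... | false = λ w _ → ∑-zero (upTo (suc N)) λ {m} _ →
  trans (cong (⟦ s * m ≡ᵇ w ⟧ *_) (*-zeroʳ ⟦ oddAdmissible s m ⟧)) (*-zeroʳ ⟦ s * m ≡ᵇ w ⟧)

marksG : ℕ → ℕ → List ℕ
marksG k s = if isEvenᵇ s then [] else [ s * k ]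

marksG-even : ∀ k s → isEvenᵇ s ≡ true → marksG k s ≡ []
marksG-even k s e rewrite e = refl

marksG-odd : ∀ k s → isEvenᵇ s ≡ false → marksG k s ≡ [ s * k ]
marksG-odd k s e rewrite e = refl

G-marking-shifts : ∀ k .{{_ : NonZero k}} N s .{{_ : NonZero s}} →
  gf (upTo (suc N)) (s *_) (λ m → ⟦ oddAdmissible s m ⟧ * (if k ≤ᵇ m then 1 else 0)) ≈[ N ] shifts (marksG k s) (sizeGF N s)
G-marking-shifts k N s = by-parity (isEvenᵇ s) refl
  where
  by-parity : ∀ p → isEvenᵇ s ≡ p →
    gf (upTo (suc N)) (s *_) (λ m → ⟦ oddAdmissible s m ⟧ * (if k ≤ᵇ m then 1 else 0)) ≈[ N ] shifts (marksG k s) (sizeGF N s)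
  by-parity true e w w≤N = begin
    gf (upTo (suc N)) (s *_) (λ m → ⟦ oddAdmissible s m ⟧ * (if k ≤ᵇ m then 1 else 0)) w
      ≡⟨ even-marking-vanishes s e _ (⟦⟧-¬T λ t → <⇒≱ (>-nonZero⁻¹ k) (≤ᵇ⇒≤ k 0 t)) (suc N) w ⟩
    shifts [] (sizeGF N s) w
      ≡⟨ cong (λ as → shifts as (sizeGF N s) w) (marksG-even k s e) ⟨
    shifts (marksG k s) (sizeGF N s) w ∎
  by-parity false e w w≤N = begin
    gf (upTo (suc N)) (s *_) (λ m → ⟦ oddAdmissible s m ⟧ * (if k ≤ᵇ m then 1 else 0)) w
      ≡⟨ odd-atLeast-shift s e N k w w≤N ⟩
    shift (s * k) (sizeGF N s) w
      ≡⟨ +-identityʳ _ ⟨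
    shifts [ s * k ] (sizeGF N s) w
      ≡⟨ cong (λ as → shifts as (sizeGF N s) w) (marksG-odd k s e) ⟨
    shifts (marksG k s) (sizeGF N s) w ∎

module MarkedCount (b N : ℕ) (mark : ℕ → ℕ → ℕ) (marks : ℕ → List ℕ)
  (marking≈shifts : ∀ s .{{_ : NonZero s}} →
     gf (upTo (suc N)) (s *_) (λ m → ⟦ oddAdmissible s m ⟧ * mark s m) ≈[ N ] shifts (marks s) (sizeGF N s)) where

  private
    module Row = ProductFormula (upTo (suc N)) _*_ oddAdmissible
    module Table = ProductFormula (vecsOf (upTo (suc N)) N) (λ (_ : ⊤) → rowWeight) (λ _ → rowOddOnly)

    rowMark : Vec ℕ N → ℕ
    rowMark row = V.sum (zipWith mark (sizes N) row)

    rowMarks : List ℕ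
    rowMarks = concatMap marks (applyUpTo suc N)

    ones : Vec ⊤ b
    ones = V.replicate b tt

    row-counting : ∀ w → Table.counting tt w ≡ rowGF N w
    row-counting w = trans (Row.product-formula (sizes N) w) (cong (λ ss → ∏ (sizeGF N) ss w) (toList-tabulate-toℕ N suc))

    row-marking : Table.marking (λ _ → rowMark) tt ≈[ N ] shifts rowMarks (Table.counting tt)
    row-marking w w≤N = begin
      Table.marking (λ _ → rowMark) tt w                               ≡⟨ Row.marked-product-formula mark (sizes N) w ⟩
      leibniz (sizeGF N) (Row.marking mark) (toList (sizes N)) w       ≡⟨ cong (λ ss → leibniz (sizeGF N) (Row.marking mark) ss w) (toList-tabulate-toℕ N suc) ⟩
      leibniz (sizeGF N) (Row.marking mark) (applyUpTo suc N) w
        ≡⟨ leibniz-shifts (sizeGF N) (Row.marking mark) marks (applyUpTo suc N) (applyUpTo⁺₂ suc N (λ i → marking≈shifts (suc i))) w w≤N ⟩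
      shifts rowMarks (rowGF N) w                                      ≡⟨ shifts-cong rowMarks (λ u _ → row-counting u) w w≤N ⟨
      shifts rowMarks (Table.counting tt) w                            ∎

    as-table : ∀ π → ⟦ (weight π ≡ᵇ N) ∧ oddOnly π ⟧ * V.sum (V.map rowMark π)
      ≡ ⟦ Table.weightOf ones π ≡ᵇ N ⟧ * (⟦ Table.admissibleᵇ ones π ⟧ * V.sum (zipWith (λ _ → rowMark) ones π))
    as-table π = begin
      ⟦ (weight π ≡ᵇ N) ∧ oddOnly π ⟧ * V.sum (V.map rowMark π)          ≡⟨ cong (_* V.sum (V.map rowMark π)) (⟦∧⟧ (weight π ≡ᵇ N) (oddOnly π)) ⟩
      ⟦ weight π ≡ᵇ N ⟧ * ⟦ oddOnly π ⟧ * V.sum (V.map rowMark π)        ≡⟨ *-assoc ⟦ weight π ≡ᵇ N ⟧ _ _ ⟩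
      ⟦ weight π ≡ᵇ N ⟧ * (⟦ oddOnly π ⟧ * V.sum (V.map rowMark π))
        ≡⟨ cong₂ (λ ws as → ⟦ V.sum ws ≡ᵇ N ⟧ * (⟦ allᵇ as ⟧ * V.sum (V.map rowMark π)))
                 (map-as-zipWith ones rowWeight π) (map-as-zipWith ones rowOddOnly π) ⟩
      ⟦ Table.weightOf ones π ≡ᵇ N ⟧ * (⟦ Table.admissibleᵇ ones π ⟧ * V.sum (V.map rowMark π))
        ≡⟨ cong (λ ms → ⟦ Table.weightOf ones π ≡ᵇ N ⟧ * (⟦ Table.admissibleᵇ ones π ⟧ * V.sum ms)) (map-as-zipWith ones rowMark π) ⟩
      ⟦ Table.weightOf ones π ≡ᵇ N ⟧ * (⟦ Table.admissibleᵇ ones π ⟧ * V.sum (zipWith (λ _ → rowMark) ones π)) ∎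

  marked-count : ∑[ π ∈ oddPartitions b N ] V.sum (V.map rowMark π) ≡ b * shifts rowMarks (tableGF b N) N
  marked-count = begin
    ∑ (filterᵇ isOddPartitionᵇ (allMult b N)) (λ π → V.sum (V.map rowMark π))
      ≡⟨ ∑-filterᵇ isOddPartitionᵇ (allMult b N) _ ⟩
    ∑[ π ∈ allMult b N ] (⟦ (weight π ≡ᵇ N) ∧ oddOnly π ⟧ * V.sum (V.map rowMark π))
      ≡⟨ ∑-cong (allMult b N) (λ {π} _ → as-table π) ⟩
    gf (allMult b N) (Table.weightOf ones) (λ π → ⟦ Table.admissibleᵇ ones π ⟧ * V.sum (zipWith (λ _ → rowMark) ones π)) N
      ≡⟨ Table.marked-product-formula (λ _ → rowMark) ones N ⟩
    leibniz Table.counting (Table.marking (λ _ → rowMark)) (toList ones) N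
      ≡⟨ cong (λ ts → leibniz Table.counting (Table.marking (λ _ → rowMark)) ts N) (toList-replicate b tt) ⟩
    leibniz Table.counting (Table.marking (λ _ → rowMark)) (replicate b tt) N
      ≡⟨ leibniz-shifts Table.counting _ (λ _ → rowMarks) (replicate b tt) (replicate⁺ b row-marking) N ≤-refl ⟩
    shifts (concatMap (λ _ → rowMarks) (replicate b tt)) (∏ Table.counting (replicate b tt)) N
      ≡⟨ shifts-cong (concatMap (λ _ → rowMarks) (replicate b tt)) (∏-cong (replicate b tt) (replicate⁺ b (λ w _ → row-counting w))) N ≤-refl ⟩
    shifts (concatMap (λ _ → rowMarks) (replicate b tt)) (tableGF b N) N
      ≡⟨ ∑-concatMap (λ _ → rowMarks) (replicate b tt) _ ⟩
    ∑[ _ ∈ replicate b tt ] shifts rowMarks (tableGF b N) N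
      ≡⟨ ∑-replicate b tt _ ⟩
    b * shifts rowMarks (tableGF b N) N ∎

-- For a ≤ N the number of b-coloured odd partitions of N ∸ a; zero for a > N.
remainderCount : ℕ → ℕ → ℕ → ℕ
remainderCount b N a = shift a (tableGF b N) N

remainderCount-+ : ∀ b k M a → remainderCount b (k + M) (k + a) ≡ remainderCount b M a
remainderCount-+ b k M a = begin
  shift (k + a) (tableGF b (k + M)) (k + M)
    ≡⟨ shift-+ k a (tableGF b (k + M)) M ⟩
  shift a (tableGF b (k + M)) M
    ≡⟨ shift-cong a (λ u u≤M → trans (cong (λ N → tableGF b N u) (+-comm k M)) (tableGF-trunc b M k u u≤M)) M ≤-refl ⟩
  shift a (tableGF b M) M ∎

F-formula : ∀ b k → isEvenᵇ k ≡ false → ∀ n → F b k n ≡ b * ∑[ j ∈ upTo n ] remainderCount b n (suc j * k)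
F-formula b k@(suc c) k-odd n = begin
  F b k n
    ≡⟨ MarkedCount.marked-count b n (λ s m → if s ≡ᵇ k then m else 0) (marksF n k) (F-marking-shifts k k-odd n) ⟩
  b * shifts (concatMap (marksF n k) (applyUpTo suc n)) (tableGF b n) n
    ≡⟨ cong (b *_) (∑-concatMap (marksF n k) (applyUpTo suc n) _) ⟩
  b * ∑[ s ∈ applyUpTo suc n ] shifts (marksF n k s) (tableGF b n) n
    ≡⟨ cong (b *_) (∑-applyUpTo suc n _) ⟩
  b * ∑[ i ∈ upTo n ] shifts (marksF n k (suc i)) (tableGF b n) n
    ≡⟨ cong (b *_) (∑-cong (upTo n) λ {i} _ → size-k-only i) ⟩
  b * ∑[ i ∈ upTo n ] (⟦ i ≡ᵇ c ⟧ * R)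
    ≡⟨ cong (b *_) (∑-upTo-⟦≡ᵇ⟧ n c R) ⟩
  b * (⟦ c <ᵇ n ⟧ * R)
    ≡⟨ cong (b *_) (indicator-absorbed (c <ᵇ n) refl) ⟩
  b * R ∎
  where
  R : ℕ
  R = ∑[ j ∈ upTo n ] remainderCount b n (suc j * k)
  size-k-only : ∀ i → shifts (marksF n k (suc i)) (tableGF b n) n ≡ ⟦ i ≡ᵇ c ⟧ * R
  size-k-only i with i ≡ᵇ c in e
  ... | false = refl
  ... | true = begin
    shifts (applyUpTo (λ j → suc i * suc j) n) (tableGF b n) n  ≡⟨ ∑-applyUpTo (λ j → suc i * suc j) n _ ⟩
    ∑[ j ∈ upTo n ] shift (suc i * suc j) (tableGF b n) n       ≡⟨ ∑-cong (upTo n) (λ {j} _ → cong (λ a → shift a (tableGF b n) n)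
                                                                    (trans (cong (λ x → suc x * suc j) (≡ᵇ⇒≡ i c (subst T (sym e) _))) (*-comm k (suc j)))) ⟩
    R                                                           ≡⟨ +-identityʳ R ⟨
    R + 0                                                       ∎
  indicator-absorbed : ∀ p → (c <ᵇ n) ≡ p → ⟦ p ⟧ * R ≡ R
  indicator-absorbed true _ = +-identityʳ R
  indicator-absorbed false e = sym (∑-zero (upTo n) λ {j} _ → shift-> (suc j * k) (tableGF b n) (<-≤-trans n<k (m≤n*m k (suc j))))
    where
    n<k : n < k
    n<k = s≤s (≮⇒≥ λ c<n → subst T e (<⇒<ᵇ c<n))

G-formula : ∀ b k .{{_ : NonZero k}} N → G b k N ≡ b * ∑[ i ∈ upTo N ] (⟦ isOddᵇ (suc i) ⟧ * remainderCount b N (suc i * k))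
G-formula b k N = begin
  G b k N
    ≡⟨ ∑-cong (oddPartitions b N) (λ {π} _ → cong V.sum (map-cong (λ row → cong V.sum (map-as-zipWith (sizes N) atLeastK row)) π)) ⟩
  ∑[ π ∈ oddPartitions b N ] V.sum (V.map (λ row → V.sum (zipWith (λ _ → atLeastK) (sizes N) row)) π)
    ≡⟨ MarkedCount.marked-count b N (λ _ → atLeastK) (marksG k) (G-marking-shifts k N) ⟩
  b * shifts (concatMap (marksG k) (applyUpTo suc N)) (tableGF b N) N
    ≡⟨ cong (b *_) (trans (∑-concatMap (marksG k) (applyUpTo suc N) _) (∑-applyUpTo suc N _)) ⟩
  b * ∑[ i ∈ upTo N ] shifts (marksG k (suc i)) (tableGF b N) N
    ≡⟨ cong (b *_) (∑-cong (upTo N) λ {i} _ → odd-sizes-only (suc i)) ⟩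
  b * ∑[ i ∈ upTo N ] (⟦ isOddᵇ (suc i) ⟧ * remainderCount b N (suc i * k)) ∎
  where
  atLeastK : ℕ → ℕ
  atLeastK m = if k ≤ᵇ m then 1 else 0
  odd-sizes-only : ∀ s → shifts (marksG k s) (tableGF b N) N ≡ ⟦ isOddᵇ s ⟧ * remainderCount b N (s * k)
  odd-sizes-only s with isEvenᵇ s
  ... | true = refl
  ... | false = refl

∑-remainderCount-∸ : ∀ b k .{{_ : NonZero k}} n →
  ∑[ i ∈ upTo (n ∸ k) ] (⟦ isOddᵇ (suc i) ⟧ * remainderCount b (n ∸ k) (suc i * k))
    ≡ ∑[ i ∈ upTo n ] (⟦ isOddᵇ (suc i) ⟧ * remainderCount b n (suc (suc i) * k))
∑-remainderCount-∸ b k n = ∑-upTo-extend _ _ (m∸n≤m n k) agree vanish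
  where
  agree : ∀ i → i < n ∸ k → ⟦ isOddᵇ (suc i) ⟧ * remainderCount b (n ∸ k) (suc i * k) ≡ ⟦ isOddᵇ (suc i) ⟧ * remainderCount b n (k + suc i * k)
  agree i i<n∸k = cong (⟦ isOddᵇ (suc i) ⟧ *_) (begin
    remainderCount b (n ∸ k) (suc i * k)              ≡⟨ remainderCount-+ b k (n ∸ k) (suc i * k) ⟨
    remainderCount b (k + (n ∸ k)) (k + suc i * k)    ≡⟨ cong (λ N → remainderCount b N (k + suc i * k)) (m+[n∸m]≡n k≤n) ⟩
    remainderCount b n (k + suc i * k)                ∎)
    where
    k≤n : k ≤ n
    k≤n = <⇒≤ (m∸n≢0⇒n<m λ n∸k≡0 → n≮0 (subst (i <_) n∸k≡0 i<n∸k))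
  vanish : ∀ i → n ∸ k ≤ i → i < n → ⟦ isOddᵇ (suc i) ⟧ * remainderCount b n (k + suc i * k) ≡ 0
  vanish i n∸k≤i _ = trans (cong (⟦ isOddᵇ (suc i) ⟧ *_) (shift-> (k + suc i * k) (tableGF b n) n<)) (*-zeroʳ ⟦ isOddᵇ (suc i) ⟧)
    where
    n< : n < k + suc i * k
    n< = ≤-<-trans (m≤n+m∸n n k) (≤-<-trans (+-monoʳ-≤ k n∸k≤i) (<-≤-trans (+-monoʳ-< k (n<1+n i)) (+-monoʳ-≤ k (m≤m*n (suc i) k))))

theorem4 : (b : ℕ) → 1 ≤ b → (n : ℕ) → 1 ≤ n → (k : ℕ) → Odd k →
    F b k n ≡ G b k n + G b k (n ∸ k)
theorem4 b _ n _ k (c , refl) = begin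
  F b k n
    ≡⟨ F-formula b k (isEvenᵇ-2*+1 c) n ⟩
  b * ∑[ j ∈ upTo n ] V (suc j)
    ≡⟨ cong (b *_) (∑-odd-split V n (shift-> (suc n * k) (tableGF b n) (m≤m*n (suc n) k))) ⟩
  b * (Gₙ + ∑[ i ∈ upTo n ] (⟦ isOddᵇ (suc i) ⟧ * V (suc (suc i))))
    ≡⟨ cong (λ x → b * (Gₙ + x)) (∑-remainderCount-∸ b k n) ⟨
  b * (Gₙ + Gₙ₋ₖ)
    ≡⟨ *-distribˡ-+ b Gₙ Gₙ₋ₖ ⟩
  b * Gₙ + b * Gₙ₋ₖ
    ≡⟨ cong₂ _+_ (G-formula b k n) (G-formula b k (n ∸ k)) ⟨
  G b k n + G b k (n ∸ k) ∎
  where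
  V : ℕ → ℕ
  V j = remainderCount b n (j * k)
  Gₙ Gₙ₋ₖ : ℕ
  Gₙ = ∑[ i ∈ upTo n ] (⟦ isOddᵇ (suc i) ⟧ * V (suc i))
  Gₙ₋ₖ = ∑[ i ∈ upTo (n ∸ k) ] (⟦ isOddᵇ (suc i) ⟧ * remainderCount b (n ∸ k) (suc i * k))
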